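{- Let $u\in\mathbb{A}^n$ be palindromically generated by a set $S\subseteq\mathcal{S}(n)$, and suppose there exist integers $p\ge1$, $q\ge0$ such that $(p,p+2q)\in S$. Then for $A=\{u[p+q]\}$ we have $\mu(d_A(u))\le\#S$.
   Context: $\mathbb{A}$ is a finite nonempty alphabet. For $u=u_1\cdots u_n$, $u[i]=u_i$ and $u[i,j]=u_i\cdots u_j$; $\mathcal{S}(n)=\{(i,j)\mid 1\le i\le j\le n\}$; $\mathrm{alph}(u)$ is the set of letters of $u$. A set $S\subseteq\mathcal{S}(n)$ palindromically generates $u\in\mathbb{A}^n$ if (1) $u[i,j]$ is a palindrome for all $(i,j)\in S$, and (2) for every nonempty set $\mathbb{B}$ and every $v\in\mathbb{B}^n$ with $v[i,j]$ a palindrome for all $(i,j)\in S$, there is a map $c\colon\mathrm{alph}(u)\to\mathbb{B}$ whose extension to a morphism satisfies $c(u)=v$. $\mu(w)$ is the minimal cardinality of a set palindromically generating $w$ ($+\infty$ if none). For $A\subseteq\mathbb{A}$, $d_A\colon\mathbb{A}^*\to\mathbb{A}^*$ is the morphism with $d_A(a)=aa$ if $a\in A$ and $d_A(a)=a$ otherwise. -}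

module Defs where

open import Data.Nat using (ℕ; zero; suc; _+_; _∸_; _≤_)
open import Data.Fin using (Fin)
open import Data.Fin.Subset using (Subset)
open import Data.Fin.Subset.Properties using (_∈?_)
open import Data.List using (List; []; _∷_; take; drop; reverse; length; map; concatMap)
open import Data.List.Relation.Unary.All using (All)
open import Data.List.Relation.Unary.Unique.Propositional using (Unique)
open import Data.Maybe using (Maybe; just; nothing)
open import Data.Product using (Σ; _×_; _,_)
open import Relation.Binary.PropositionalEquality using (_≡_)
open import Relation.Nullary using (yes; no; Dec)

-- 1-indexed letter u[i]  (nothing if out of range)
at : {X : Set} → List X → ℕ → Maybe X
at []       _             = nothing
at (x ∷ xs) zero          = nothing
at (x ∷ xs) (suc zero)    = just x
at (x ∷ xs) (suc (suc i)) = at xs (suc i)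

-- factor u[i,j] = u_i ⋯ u_j  (1-indexed)
factor : {X : Set} → List X → ℕ × ℕ → List X
factor u (i , j) = take (suc j ∸ i) (drop (i ∸ 1) u)

IsPalindrome : {X : Set} → List X → Set
IsPalindrome w = reverse w ≡ w

InS : ℕ → ℕ × ℕ → Set
InS n (i , j) = (1 ≤ i) × (i ≤ j) × (j ≤ n)

PalOn : {X : Set} → List (ℕ × ℕ) → List X → Set
PalOn S w = All (λ ij → IsPalindrome (factor w ij)) S

PalGen : {k : ℕ} → List (ℕ × ℕ) → List (Fin (suc k)) → Set₁
PalGen {k} S u =
  Unique S × All (InS (length u)) S × PalOn S u ×
  ((B : Set) → B → (v : List B) → length v ≡ length u → PalOn S v →
     Σ (Fin (suc k) → B) (λ c → map c u ≡ v))

-- μ(w) ≤ m : some set of cardinality ≤ m palindromically generates w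
μ≤ : {k : ℕ} → List (Fin (suc k)) → ℕ → Set₁
μ≤ w m = Σ (List (ℕ × ℕ)) (λ S → PalGen S w × length S ≤ m)

d : {k : ℕ} → Subset (suc k) → List (Fin (suc k)) → List (Fin (suc k))
d {k} A = concatMap (λ x → dbl x (x ∈? A))
  where
  dbl : {P : Set} → Fin (suc k) → Dec P → List (Fin (suc k))
  dbl x (yes _) = x ∷ x ∷ []
  dbl x (no _)  = x ∷ []

-- Let φ send an interval of positions of u to the interval occupied by the corresponding
-- blocks of d_A(u). Every block is a palindrome, so d_A(u) is palindromic on φ(S), a set of
-- #S intervals. Conversely, cut a word v that is palindromic on φ(S) into blocks along
-- d_A(u): each (i , j) ∈ S reverses the sequence of blocks and reverses every block, so the
-- block of v at a position is the reversal of the block at its mirror image. Hence the set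
-- of positions carrying a palindromic block is closed under the reflections of S, and it
-- contains the centre p + q of (p , p + 2q). Any reflection-closed set of positions is a
-- union of letter classes of u (its characteristic word is palindromic on S, hence a coding
-- of u), so all blocks at occurrences of a = u[p + q] are palindromes of length 2, i.e.
-- constant, while all other blocks have length 1. Since S generates u, the sequence of
-- blocks is a coding of u, and v is the image of d_A(u) under the coding sending each letter
-- to the first letter of its block.

module Submission where

open import Defs
open import Data.Bool using (Bool; true; false; T; _∧_; _∨_)
open import Data.Bool.ListAction using (any)
open import Data.Bool.Properties using (T-∧; T-∨)
open import Data.Empty using (⊥-elim)
open import Data.Fin using (Fin)
open import Data.Fin.Subset as Subset using (Subset; ⁅_⁆)
open import Data.Fin.Subset.Properties using (_∈?_; x∈⁅y⁆⇒x≡y)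
open import Data.List
  using (List; []; _∷_; _++_; take; drop; reverse; length; map; concat; head; applyUpTo)
open import Data.List.Membership.Propositional using (_∈_; find; lose)
open import Data.List.Membership.Propositional.Properties using (∈-map⁺)
open import Data.List.Properties
  using ( unfold-reverse; reverse-++; reverse-map; reverse-involutive; length-reverse; length-map
        ; length-take; length-drop; length-++; length-applyUpTo; map-++; map-∘; map-cong; map-cong-local
        ; map-id; map-id-local; concat-++; concat-map; ++-identityʳ; take++drop≡id; take-map; drop-map
        ; take-[]; drop-[]; ∷-injective)
open import Data.List.Relation.Unary.All as All using (All; []; _∷_)
import Data.List.Relation.Unary.All.Properties as All
open import Data.List.Relation.Unary.AllPairs using ([]; _∷_)
open import Data.List.Relation.Unary.Any.Properties using (any⁺; any⁻)
open import Data.List.Relation.Unary.Unique.Propositional using (Unique)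
open import Data.Maybe using (Maybe; just; nothing; fromMaybe)
import Data.Maybe as Maybe
open import Data.Maybe.Properties using (just-injective)
open import Data.Nat using (ℕ; zero; suc; _+_; _*_; _∸_; _⊓_; _≤_; _<_; z≤n; s≤s; _≤ᵇ_; _≡ᵇ_)
open import Data.Nat.ListAction using (sum)
open import Data.Nat.Properties
open import Data.Nat.Tactic.RingSolver using (solve-∀)
open import Data.Product using (Σ; ∃; _×_; _,_; proj₁; proj₂)
open import Data.Sum using (_⊎_; inj₁; inj₂)
open import Data.Unit using (tt)
open import Function using (_∘_; id; Equivalence)
open import Relation.Binary.Definitions using (tri<; tri≈; tri>)
open import Relation.Binary.PropositionalEquality
open import Relation.Nullary using (¬_; yes; no; contradiction)
open import Relation.Nullary.Decidable using (T?; _×-dec_; ¬?)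

private variable
  X Y : Set

-- Reflections in intervals

infix 4 _∈ᴵ_

_∈ᴵ_ : ℕ → ℕ × ℕ → Set
t ∈ᴵ (i , j) = i ≤ t × t ≤ j

-- The mirror image of position t in the interval I; meaningless outside I, where ∸ truncates.
reflect : ℕ × ℕ → ℕ → ℕ
reflect (i , j) t = i + j ∸ t

reflect-unique : ∀ i j t {s} → t + s ≡ i + j → reflect (i , j) t ≡ s
reflect-unique i j t {s} eq = trans (cong (_∸ t) (sym eq)) (m+n∸m≡n t s)

reflect-∈ᴵ : ∀ {I} t → t ∈ᴵ I → reflect I t ∈ᴵ I
reflect-∈ᴵ {i , j} t (i≤t , t≤j) with m≤n⇒∃[o]m+o≡n i≤t | m≤n⇒∃[o]m+o≡n t≤j
... | x , refl | y , refl =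
  subst (_∈ᴵ (i , i + x + y)) (sym (reflect-unique i (i + x + y) (i + x) (balance i x y)))
        (m≤m+n i y , +-monoˡ-≤ y (m≤m+n i x))
  where
  balance : ∀ i x y → (i + x) + (i + y) ≡ i + (i + x + y)
  balance = solve-∀

reflect-involutive : ∀ {I} t → t ∈ᴵ I → reflect I (reflect I t) ≡ t
reflect-involutive {i , j} t (_ , t≤j) =
  reflect-unique i j (reflect (i , j) t)
    (trans (+-comm (reflect (i , j) t) t) (m+[n∸m]≡n (≤-trans t≤j (m≤n+m j i))))

reflect-centre : ∀ p q → reflect (p , p + 2 * q) (p + q) ≡ p + q
reflect-centre p q = reflect-unique p (p + 2 * q) (p + q) (balance p q)
  where
  balance : ∀ p q → (p + q) + (p + q) ≡ p + (p + 2 * q)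
  balance = solve-∀

shift-∈ᴵ : ∀ a {m s} → s ∈ᴵ (1 , m) → a + s ∈ᴵ (suc a , a + m)
shift-∈ᴵ a {s = s} (1≤s , s≤m) = subst (_≤ a + s) (+-comm a 1) (+-monoʳ-≤ a 1≤s) , +-monoʳ-≤ a s≤m

unshift-∈ᴵ : ∀ a {m t} → t ∈ᴵ (suc a , a + m) → ∃ λ s → t ≡ a + s × s ∈ᴵ (1 , m)
unshift-∈ᴵ a {m} (a<t , t≤a+m) with m≤n⇒∃[o]m+o≡n (<⇒≤ a<t)
... | s , refl = s , refl ,
  +-cancelˡ-≤ a 1 s (subst (_≤ a + s) (+-comm 1 a) a<t) , +-cancelˡ-≤ a s m t≤a+m

reflect-shift : ∀ a {m s} → s ∈ᴵ (1 , m) → reflect (suc a , a + m) (a + s) ≡ a + reflect (1 , m) s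
reflect-shift a {m} {s} (_ , s≤m) = reflect-unique (suc a) (a + m) (a + s) (begin
  (a + s) + (a + r)    ≡⟨ regroup a s r ⟩
  a + a + (s + r)      ≡⟨ cong (a + a +_) (m+[n∸m]≡n (m≤n⇒m≤1+n s≤m)) ⟩
  a + a + suc m        ≡⟨ regroup′ a m ⟩
  suc a + (a + m)      ∎)
  where
  open ≡-Reasoning
  r : ℕ
  r = reflect (1 , m) s
  regroup : ∀ a s r → (a + s) + (a + r) ≡ a + a + (s + r)
  regroup = solve-∀
  regroup′ : ∀ a m → a + a + suc m ≡ suc a + (a + m)
  regroup′ = solve-∀

at-map : (f : X → Y) (xs : List X) (t : ℕ) → at (map f xs) t ≡ Maybe.map f (at xs t)
at-map f []       t             = refl
at-map f (x ∷ xs) zero          = refl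
at-map f (x ∷ xs) (suc zero)    = refl
at-map f (x ∷ xs) (suc (suc t)) = at-map f xs (suc t)

at-++ˡ : (xs ys : List X) (k : ℕ) → k < length xs → at (xs ++ ys) (suc k) ≡ at xs (suc k)
at-++ˡ (x ∷ xs) ys zero    _         = refl
at-++ˡ (x ∷ xs) ys (suc k) (s≤s k<n) = at-++ˡ xs ys k k<n

at-++-length : (xs : List X) (y : X) → at (xs ++ y ∷ []) (suc (length xs)) ≡ just y
at-++-length []       y = refl
at-++-length (x ∷ xs) y = at-++-length xs y

at-drop : (a : ℕ) (xs : List X) (k : ℕ) → at (drop a xs) (suc k) ≡ at xs (suc (a + k))
at-drop zero    xs       k = refl
at-drop (suc a) []       k = refl
at-drop (suc a) (x ∷ xs) k = at-drop a xs k

at-take : (m : ℕ) (xs : List X) (k : ℕ) → k < m → at (take m xs) (suc k) ≡ at xs (suc k)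
at-take (suc m) []       k       _         = refl
at-take (suc m) (x ∷ xs) zero    _         = refl
at-take (suc m) (x ∷ xs) (suc k) (s≤s k<m) = at-take m xs k k<m

at-reverse : (xs : List X) (k : ℕ) → k < length xs → at (reverse xs) (suc k) ≡ at xs (length xs ∸ k)
at-reverse (x ∷ xs) k (s≤s k≤n) rewrite unfold-reverse x xs with m≤n⇒m<n∨m≡n k≤n
... | inj₁ k<n = begin
  at (reverse xs ++ x ∷ []) (suc k)   ≡⟨ at-++ˡ (reverse xs) _ k (subst (k <_) (sym (length-reverse xs)) k<n) ⟩
  at (reverse xs) (suc k)             ≡⟨ at-reverse xs k k<n ⟩
  at xs (length xs ∸ k)               ≡⟨ cong (at xs) (+-∸-assoc 1 k<n) ⟩
  at xs (suc (length xs ∸ suc k))     ≡⟨⟩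
  at (x ∷ xs) (suc (suc (length xs ∸ suc k)))
    ≡⟨ cong (at (x ∷ xs)) (sym (trans (+-∸-assoc 1 k≤n) (cong suc (+-∸-assoc 1 k<n)))) ⟩
  at (x ∷ xs) (suc (length xs) ∸ k)   ∎
  where open ≡-Reasoning
... | inj₂ refl = begin
  at (reverse xs ++ x ∷ []) (suc (length xs))
    ≡⟨ cong (λ l → at (reverse xs ++ x ∷ []) (suc l)) (sym (length-reverse xs)) ⟩
  at (reverse xs ++ x ∷ []) (suc (length (reverse xs)))
    ≡⟨ at-++-length (reverse xs) x ⟩
  just x
    ≡⟨ cong (at (x ∷ xs)) (sym (m+n∸n≡m 1 (length xs))) ⟩
  at (x ∷ xs) (suc (length xs) ∸ length xs)   ∎
  where open ≡-Reasoning

≡-by-at : (xs ys : List X) → length xs ≡ length ys →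
          (∀ k → k < length xs → at xs (suc k) ≡ at ys (suc k)) → xs ≡ ys
≡-by-at []       []       _   _    = refl
≡-by-at (x ∷ xs) (y ∷ ys) len same with same zero (s≤s z≤n)
... | refl = cong (x ∷_) (≡-by-at xs ys (suc-injective len) (λ k k<n → same (suc k) (s≤s k<n)))

at-just⇒∈ᴵ : (xs : List X) (t : ℕ) {x : X} → at xs t ≡ just x → t ∈ᴵ (1 , length xs)
at-just⇒∈ᴵ (y ∷ xs) (suc zero)    _  = s≤s z≤n , s≤s z≤n
at-just⇒∈ᴵ (y ∷ xs) (suc (suc t)) eq = s≤s z≤n , s≤s (proj₂ (at-just⇒∈ᴵ xs (suc t) eq))

at-∈ᴵ⇒just : (xs : List X) (t : ℕ) → t ∈ᴵ (1 , length xs) → ∃ λ x → at xs t ≡ just x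
at-∈ᴵ⇒just (x ∷ xs) (suc zero)    _               = x , refl
at-∈ᴵ⇒just (x ∷ xs) (suc (suc t)) (_ , s≤s t<n) = at-∈ᴵ⇒just xs (suc t) (s≤s z≤n , t<n)

at-applyUpTo : (f : ℕ → X) (n k : ℕ) → k < n → at (applyUpTo f n) (suc k) ≡ just (f k)
at-applyUpTo f (suc n) zero    _         = refl
at-applyUpTo f (suc n) (suc k) (s≤s k<n) = at-applyUpTo (f ∘ suc) n k k<n

All-from-at : (P : X → Set) (xs : List X) → (∀ k {x} → at xs (suc k) ≡ just x → P x) → All P xs
All-from-at P []       _    = []
All-from-at P (x ∷ xs) P-at = P-at zero refl ∷ All-from-at P xs (P-at ∘ suc)

-- Mirrored factors

Mirrored : (X → X) → List X → ℕ × ℕ → Set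
Mirrored g w I = ∀ t → t ∈ᴵ I → at w (reflect I t) ≡ Maybe.map g (at w t)

reverse≡map⇒Mirrored : (g : X → X) (s : List X) → reverse s ≡ map g s → Mirrored g s (1 , length s)
reverse≡map⇒Mirrored g s eq (suc k) (_ , k<n) = begin
  at s (length s ∸ k)          ≡⟨ at-reverse s k k<n ⟨
  at (reverse s) (suc k)       ≡⟨ cong (λ z → at z (suc k)) eq ⟩
  at (map g s) (suc k)         ≡⟨ at-map g s (suc k) ⟩
  Maybe.map g (at s (suc k))   ∎
  where open ≡-Reasoning

Mirrored⇒reverse≡map : (g : X → X) (s : List X) → Mirrored g s (1 , length s) → reverse s ≡ map g s
Mirrored⇒reverse≡map g s mirrored =
  ≡-by-at (reverse s) (map g s) (trans (length-reverse s) (sym (length-map g s))) λ k k<n →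
    let k<n′ = subst (k <_) (length-reverse s) k<n in begin
    at (reverse s) (suc k)       ≡⟨ at-reverse s k k<n′ ⟩
    at s (length s ∸ k)          ≡⟨ mirrored (suc k) (s≤s z≤n , k<n′) ⟩
    Maybe.map g (at s (suc k))   ≡⟨ at-map g s (suc k) ⟨
    at (map g s) (suc k)         ∎
  where open ≡-Reasoning

factor-shifted : (w : List X) (a m : ℕ) → factor w (suc a , a + m) ≡ take m (drop a w)
factor-shifted w a m = cong (λ l → take l (drop a w)) (m+n∸m≡n a m)

length-factor : (w : List X) (a m : ℕ) → a + m ≤ length w → length (factor w (suc a , a + m)) ≡ m
length-factor w a m a+m≤n = begin
  length (factor w (suc a , a + m))  ≡⟨ cong length (factor-shifted w a m) ⟩
  length (take m (drop a w))         ≡⟨ length-take m (drop a w) ⟩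
  m ⊓ length (drop a w)              ≡⟨ cong (m ⊓_) (length-drop a w) ⟩
  m ⊓ (length w ∸ a)                 ≡⟨ m≤n⇒m⊓n≡m (m+n≤o⇒m≤o∸n m (subst (_≤ length w) (+-comm a m) a+m≤n)) ⟩
  m                                  ∎
  where open ≡-Reasoning

at-factor : (w : List X) (a m : ℕ) → ∀ s → s ∈ᴵ (1 , m) → at (factor w (suc a , a + m)) s ≡ at w (a + s)
at-factor w a m (suc k) (_ , k<m) = begin
  at (factor w (suc a , a + m)) (suc k)   ≡⟨ cong (λ z → at z (suc k)) (factor-shifted w a m) ⟩
  at (take m (drop a w)) (suc k)          ≡⟨ at-take m (drop a w) k k<m ⟩
  at (drop a w) (suc k)                   ≡⟨ at-drop a w k ⟩
  at w (suc (a + k))                      ≡⟨ cong (at w) (+-suc a k) ⟨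
  at w (a + suc k)                        ∎
  where open ≡-Reasoning

factor-Mirrored⇒Mirrored : (g : X → X) (w : List X) (a m : ℕ) →
  Mirrored g (factor w (suc a , a + m)) (1 , m) → Mirrored g w (suc a , a + m)
factor-Mirrored⇒Mirrored g w a m mirrored t t∈ with unshift-∈ᴵ a t∈
... | s , refl , s∈ = begin
  at w (reflect (suc a , a + m) (a + s))              ≡⟨ cong (at w) (reflect-shift a s∈) ⟩
  at w (a + reflect (1 , m) s)                        ≡⟨ at-factor w a m _ (reflect-∈ᴵ s s∈) ⟨
  at (factor w (suc a , a + m)) (reflect (1 , m) s)   ≡⟨ mirrored s s∈ ⟩
  Maybe.map g (at (factor w (suc a , a + m)) s)       ≡⟨ cong (Maybe.map g) (at-factor w a m s s∈) ⟩
  Maybe.map g (at w (a + s))                          ∎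
  where open ≡-Reasoning

Mirrored⇒factor-Mirrored : (g : X → X) (w : List X) (a m : ℕ) →
  Mirrored g w (suc a , a + m) → Mirrored g (factor w (suc a , a + m)) (1 , m)
Mirrored⇒factor-Mirrored g w a m mirrored s s∈ = begin
  at (factor w (suc a , a + m)) (reflect (1 , m) s)   ≡⟨ at-factor w a m _ (reflect-∈ᴵ s s∈) ⟩
  at w (a + reflect (1 , m) s)                        ≡⟨ cong (at w) (reflect-shift a s∈) ⟨
  at w (reflect (suc a , a + m) (a + s))              ≡⟨ mirrored (a + s) (shift-∈ᴵ a s∈) ⟩
  Maybe.map g (at w (a + s))                          ≡⟨ cong (Maybe.map g) (at-factor w a m s s∈) ⟨
  Maybe.map g (at (factor w (suc a , a + m)) s)       ∎
  where open ≡-Reasoning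

reverse-factor⇒Mirrored : (g : X → X) (w : List X) {I : ℕ × ℕ} → InS (length w) I →
  reverse (factor w I) ≡ map g (factor w I) → Mirrored g w I
reverse-factor⇒Mirrored g w {suc a , j} (_ , i≤j , j≤n) eq with m≤n⇒∃[o]m+o≡n (<⇒≤ i≤j)
... | m , refl = factor-Mirrored⇒Mirrored g w a m
  (subst (λ l → Mirrored g (factor w (suc a , a + m)) (1 , l)) (length-factor w a m j≤n)
         (reverse≡map⇒Mirrored g (factor w (suc a , a + m)) eq))

Mirrored⇒reverse-factor : (g : X → X) (w : List X) {I : ℕ × ℕ} → InS (length w) I →
  Mirrored g w I → reverse (factor w I) ≡ map g (factor w I)
Mirrored⇒reverse-factor g w {suc a , j} (_ , i≤j , j≤n) mirrored with m≤n⇒∃[o]m+o≡n (<⇒≤ i≤j)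
... | m , refl = Mirrored⇒reverse≡map g (factor w (suc a , a + m))
  (subst (λ l → Mirrored g (factor w (suc a , a + m)) (1 , l)) (sym (length-factor w a m j≤n))
         (Mirrored⇒factor-Mirrored g w a m mirrored))

-- Lists of blocks

factor-map : (f : X → Y) (xs : List X) (I : ℕ × ℕ) → factor (map f xs) I ≡ map f (factor xs I)
factor-map f xs (i , j) =
  trans (cong (take (suc j ∸ i)) (drop-map (i ∸ 1) xs)) (take-map (suc j ∸ i) (drop (i ∸ 1) xs))

IsPalindrome-map : (f : X → Y) {xs : List X} → IsPalindrome xs → IsPalindrome (map f xs)
IsPalindrome-map f {xs} pal = trans (sym (reverse-map f xs)) (cong (map f) pal)

length-1-palindrome : (xs : List X) → length xs ≡ 1 → IsPalindrome xs
length-1-palindrome (x ∷ []) _ = refl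

map-≡⇒All : (f g : X → Y) (xs : List X) → map f xs ≡ map g xs → All (λ x → f x ≡ g x) xs
map-≡⇒All f g []       _  = []
map-≡⇒All f g (x ∷ xs) eq with ∷-injective eq
... | fx≡gx , rest = fx≡gx ∷ map-≡⇒All f g xs rest

Unique-map⁺-on : (P : X → Set) (f : X → Y) → (∀ {x y} → P x → P y → f x ≡ f y → x ≡ y) →
                 ∀ {xs} → All P xs → Unique xs → Unique (map f xs)
Unique-map⁺-on P f injective {[]}     []         []         = []
Unique-map⁺-on P f injective {x ∷ xs} (px ∷ pxs) (x∉ ∷ uniq) =
  distinct pxs x∉ ∷ Unique-map⁺-on P f injective pxs uniq
  where
  distinct : ∀ {ys} → All P ys → All (λ y → ¬ x ≡ y) ys → All (λ z → ¬ f x ≡ z) (map f ys)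
  distinct []         []         = []
  distinct (py ∷ pys) (x≢y ∷ x≢ys) = (x≢y ∘ injective px py) ∷ distinct pys x≢ys

Maybe-map-reverse-involutive : (m : Maybe (List X)) → Maybe.map reverse (Maybe.map reverse m) ≡ m
Maybe-map-reverse-involutive nothing   = refl
Maybe-map-reverse-involutive (just xs) = cong just (reverse-involutive xs)

take-++-length : (xs ys : List X) (k : ℕ) → take (length xs + k) (xs ++ ys) ≡ xs ++ take k ys
take-++-length []       ys k = refl
take-++-length (x ∷ xs) ys k = cong (x ∷_) (take-++-length xs ys k)

drop-++-length : (xs ys : List X) (k : ℕ) → drop (length xs + k) (xs ++ ys) ≡ drop k ys
drop-++-length []       ys k = refl
drop-++-length (x ∷ xs) ys k = drop-++-length xs ys k

++-cancel-length : (xs ys zs ws : List X) → length xs ≡ length ys → xs ++ zs ≡ ys ++ ws → xs ≡ ys × zs ≡ ws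
++-cancel-length []       []       zs ws _   eq = refl , eq
++-cancel-length (x ∷ xs) (y ∷ ys) zs ws len eq with ∷-injective eq
... | refl , eq′ with ++-cancel-length xs ys zs ws (suc-injective len) eq′
...   | refl , zs≡ws = refl , zs≡ws

length-concat : (Bs : List (List X)) → length (concat Bs) ≡ sum (map length Bs)
length-concat []       = refl
length-concat (B ∷ Bs) = trans (length-++ B) (cong (length B +_) (length-concat Bs))

concat-injective : (Bs Cs : List (List X)) → map length Bs ≡ map length Cs → concat Bs ≡ concat Cs → Bs ≡ Cs
concat-injective []       []       _   _  = refl
concat-injective (B ∷ Bs) (C ∷ Cs) len eq with ∷-injective len
... | lenB , lenBs with ++-cancel-length B C (concat Bs) (concat Cs) lenB eq
...   | refl , eq′ = cong (B ∷_) (concat-injective Bs Cs lenBs eq′)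

reverse-concat : (Bs : List (List X)) → reverse (concat Bs) ≡ concat (map reverse (reverse Bs))
reverse-concat []       = refl
reverse-concat (B ∷ Bs) = begin
  reverse (B ++ concat Bs)
    ≡⟨ reverse-++ B (concat Bs) ⟩
  reverse (concat Bs) ++ reverse B
    ≡⟨ cong₂ _++_ (reverse-concat Bs) (sym (++-identityʳ (reverse B))) ⟩
  concat (map reverse (reverse Bs)) ++ concat (reverse B ∷ [])
    ≡⟨ concat-++ (map reverse (reverse Bs)) _ ⟩
  concat (map reverse (reverse Bs) ++ reverse B ∷ [])
    ≡⟨ cong concat (map-++ reverse (reverse Bs) (B ∷ [])) ⟨
  concat (map reverse (reverse Bs ++ B ∷ []))
    ≡⟨ cong (concat ∘ map reverse) (unfold-reverse B Bs) ⟨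
  concat (map reverse (reverse (B ∷ Bs)))   ∎
  where open ≡-Reasoning

map-reverse-involutive : (Bs : List (List X)) → map reverse (map reverse Bs) ≡ Bs
map-reverse-involutive Bs = trans (sym (map-∘ Bs)) (trans (map-cong reverse-involutive Bs) (map-id Bs))

IsPalindrome-concat⁺ : (Bs : List (List X)) → reverse Bs ≡ map reverse Bs → IsPalindrome (concat Bs)
IsPalindrome-concat⁺ Bs eq = begin
  reverse (concat Bs)                       ≡⟨ reverse-concat Bs ⟩
  concat (map reverse (reverse Bs))         ≡⟨ cong (concat ∘ map reverse) eq ⟩
  concat (map reverse (map reverse Bs))     ≡⟨ cong concat (map-reverse-involutive Bs) ⟩
  concat Bs                                 ∎
  where open ≡-Reasoning

IsPalindrome-concat⁻ : (Bs : List (List X)) → IsPalindrome (map length Bs) → IsPalindrome (concat Bs) →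
                       reverse Bs ≡ map reverse Bs
IsPalindrome-concat⁻ Bs lengths-pal pal = begin
  reverse Bs                                ≡⟨ map-reverse-involutive (reverse Bs) ⟨
  map reverse (map reverse (reverse Bs))    ≡⟨ cong (map reverse) reversed ⟩
  map reverse Bs                            ∎
  where
  open ≡-Reasoning
  lengths : map length (map reverse (reverse Bs)) ≡ map length Bs
  lengths = begin
    map length (map reverse (reverse Bs))   ≡⟨ map-∘ (reverse Bs) ⟨
    map (length ∘ reverse) (reverse Bs)     ≡⟨ map-cong length-reverse (reverse Bs) ⟩
    map length (reverse Bs)                 ≡⟨ reverse-map length Bs ⟩
    reverse (map length Bs)                 ≡⟨ lengths-pal ⟩
    map length Bs                           ∎
  reversed : map reverse (reverse Bs) ≡ Bs
  reversed = concat-injective _ Bs lengths (trans (sym (reverse-concat Bs)) pal)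

offset : List ℕ → ℕ → ℕ
offset ls m = sum (take m ls)

take-concat : (Bs : List (List X)) (m : ℕ) → take (offset (map length Bs) m) (concat Bs) ≡ concat (take m Bs)
take-concat Bs       zero    = refl
take-concat []       (suc m) = refl
take-concat (B ∷ Bs) (suc m) = trans (take-++-length B (concat Bs) _) (cong (B ++_) (take-concat Bs m))

factor-[] : ∀ I → factor {X} [] I ≡ []
factor-[] (i , j) = trans (cong (take (suc j ∸ i)) (drop-[] (i ∸ 1))) (take-[] (suc j ∸ i))

factor-concat : (Bs : List (List X)) (a j : ℕ) → let ls = map length Bs in
  factor (concat Bs) (suc (offset ls a) , offset ls j) ≡ concat (factor Bs (suc a , j))
factor-concat Bs       zero    j       = take-concat Bs j
factor-concat []       (suc a) j       =
  trans (factor-[] (1 , offset [] j)) (cong concat (sym (factor-[] (suc (suc a) , j))))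
factor-concat (B ∷ Bs) (suc a) zero    =
  cong (λ l → take l (drop (length B + offset (map length Bs) a) (B ++ concat Bs)))
       (0∸n≡0 (length B + offset (map length Bs) a))
factor-concat (B ∷ Bs) (suc a) (suc j) = begin
  take ((length B + oj) ∸ (length B + oa)) (drop (length B + oa) (B ++ concat Bs))
    ≡⟨ cong₂ take ([m+n]∸[m+o]≡n∸o (length B) oj oa) (drop-++-length B (concat Bs) oa) ⟩
  take (oj ∸ oa) (drop oa (concat Bs))
    ≡⟨ factor-concat Bs a j ⟩
  concat (factor Bs (suc a , j))   ∎
  where
  open ≡-Reasoning
  oa oj : ℕ
  oa = offset (map length Bs) a
  oj = offset (map length Bs) j

offset-< : (ls : List ℕ) → All (1 ≤_) ls → ∀ {m m′} → m < m′ → m′ ≤ length ls → offset ls m < offset ls m′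
offset-< (l ∷ ls) (1≤l ∷ _)   {zero}  {suc m′} _          _            = ≤-trans 1≤l (m≤m+n l _)
offset-< (l ∷ ls) (_ ∷ 1≤ls) {suc m} {suc m′} (s≤s m<m′) (s≤s m′≤n) = +-monoʳ-< l (offset-< ls 1≤ls m<m′ m′≤n)

offset-injective : (ls : List ℕ) → All (1 ≤_) ls → ∀ {m m′} → m ≤ length ls → m′ ≤ length ls →
                   offset ls m ≡ offset ls m′ → m ≡ m′
offset-injective ls 1≤ls {m} {m′} m≤n m′≤n eq with <-cmp m m′
... | tri< m<m′ _ _ = contradiction eq (<⇒≢ (offset-< ls 1≤ls m<m′ m′≤n))
... | tri≈ _ m≡m′ _ = m≡m′
... | tri> _ _ m′<m = contradiction (sym eq) (<⇒≢ (offset-< ls 1≤ls m′<m m≤n))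

offset-≤-sum : (ls : List ℕ) (m : ℕ) → offset ls m ≤ sum ls
offset-≤-sum ls       zero    = z≤n
offset-≤-sum []       (suc m) = z≤n
offset-≤-sum (l ∷ ls) (suc m) = +-monoʳ-≤ l (offset-≤-sum ls m)

chunk : List ℕ → List X → List (List X)
chunk []       v = []
chunk (l ∷ ls) v = take l v ∷ chunk ls (drop l v)

length-drop-sum : (l : ℕ) (ls : List ℕ) (v : List X) → length v ≡ l + sum ls → length (drop l v) ≡ sum ls
length-drop-sum l ls v len = trans (length-drop l v) (trans (cong (_∸ l) len) (m+n∸m≡n l (sum ls)))

concat-chunk : (ls : List ℕ) (v : List X) → length v ≡ sum ls → concat (chunk ls v) ≡ v
concat-chunk []       []      _   = refl
concat-chunk (l ∷ ls) v       len =
  trans (cong (take l v ++_) (concat-chunk ls (drop l v) (length-drop-sum l ls v len))) (take++drop≡id l v)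

map-length-chunk : (ls : List ℕ) (v : List X) → length v ≡ sum ls → map length (chunk ls v) ≡ ls
map-length-chunk []       v _   = refl
map-length-chunk (l ∷ ls) v len = cong₂ _∷_
  (trans (length-take l v) (m≤n⇒m⊓n≡m (subst (l ≤_) (sym len) (m≤m+n l (sum ls)))))
  (map-length-chunk ls (drop l v) (length-drop-sum l ls v len))

-- Closures of sets of positions

T-extensional : ∀ {a b} → (T a → T b) → (T b → T a) → a ≡ b
T-extensional {false} {false} _  _  = refl
T-extensional {false} {true}  _  ba = ⊥-elim (ba tt)
T-extensional {true}  {false} ab _  = ⊥-elim (ab tt)
T-extensional {true}  {true}  _  _  = refl

indicator : Bool → ℕ
indicator false = 0
indicator true  = 1

indicator-mono : ∀ {a b} → (T a → T b) → indicator a ≤ indicator b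
indicator-mono {false}         _  = z≤n
indicator-mono {true} {true}   _  = ≤-refl
indicator-mono {true} {false} ab = ⊥-elim (ab tt)

indicator-strict : ∀ {a b} → ¬ T a → T b → indicator a < indicator b
indicator-strict {false} {true}  _  _  = s≤s z≤n
indicator-strict {true}          ¬a _  = ⊥-elim (¬a tt)
indicator-strict {false} {false} _  ()

-- Sets of positions are Boolean predicates on ℕ.
count : (ℕ → Bool) → ℕ → ℕ
count X zero    = 0
count X (suc m) = indicator (X (suc m)) + count X m

count-≤ : ∀ X m → count X m ≤ m
count-≤ X zero    = z≤n
count-≤ X (suc m) = +-mono-≤ (indicator-mono {X (suc m)} (λ _ → tt)) (count-≤ X m)

count-mono : ∀ {X Z} → (∀ t → T (X t) → T (Z t)) → ∀ m → count X m ≤ count Z m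
count-mono X⊆Z zero    = z≤n
count-mono X⊆Z (suc m) = +-mono-≤ (indicator-mono (X⊆Z (suc m))) (count-mono X⊆Z m)

count-strict : ∀ {X Z} → (∀ t → T (X t) → T (Z t)) → ∀ {t} m → t ∈ᴵ (1 , m) → ¬ T (X t) → T (Z t) →
               count X m < count Z m
count-strict X⊆Z zero    (s≤s _ , ()) _ _
count-strict X⊆Z {t} (suc m) (1≤t , t≤m) ¬x z with m≤n⇒m<n∨m≡n t≤m
... | inj₁ (s≤s t≤m′) = +-mono-≤-< (indicator-mono (X⊆Z (suc m))) (count-strict X⊆Z m (1≤t , t≤m′) ¬x z)
... | inj₂ refl       = +-mono-<-≤ (indicator-strict ¬x z) (count-mono X⊆Z m)

module Closure (n : ℕ) (step : (ℕ → Bool) → ℕ → Bool)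
               (inflationary : ∀ X t → T (X t) → T (step X t)) where

  Closed : (ℕ → Bool) → Set
  Closed X = ∀ t → t ∈ᴵ (1 , n) → T (step X t) → T (X t)

  Grows : (ℕ → Bool) → Set
  Grows X = ∃ λ t → t ∈ᴵ (1 , n) × ¬ T (X t) × T (step X t)

  grows? : ∀ X → Grows X ⊎ Closed X
  grows? X with anyUpTo? (λ k → ¬? (T? (X (suc k))) ×-dec T? (step X (suc k))) n
  ... | yes (k , k<n , ¬x , x′) = inj₁ (suc k , (s≤s z≤n , k<n) , ¬x , x′)
  ... | no ¬grows = inj₂ closed
    where
    closed : Closed X
    closed (suc k) (_ , k<n) x′ with T? (X (suc k))
    ... | yes x = x
    ... | no ¬x = contradiction (k , k<n , ¬x , x′) ¬grows

  iterate : ℕ → (ℕ → Bool) → ℕ → Bool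
  iterate zero    X = X
  iterate (suc f) X with grows? X
  ... | inj₁ _ = iterate f (step X)
  ... | inj₂ _ = X

  -- Each non-final round adds a position of [1, n], so n rounds of fuel plus the
  -- positions already present suffice.
  iterate-closed : ∀ f X → n < f + count X n → Closed (iterate f X)
  iterate-closed zero    X n<c = contradiction (count-≤ X n) (<⇒≱ n<c)
  iterate-closed (suc f) X n<f+c with grows? X
  ... | inj₂ closed                 = closed
  ... | inj₁ (t , t∈ , ¬x , x′) = iterate-closed f (step X) (begin-strict
    n                          <⟨ n<f+c ⟩
    suc f + count X n          ≡⟨ +-suc f (count X n) ⟨
    f + suc (count X n)        ≤⟨ +-monoʳ-≤ f (count-strict (inflationary X) n t∈ ¬x x′) ⟩
    f + count (step X) n       ∎)
    where open ≤-Reasoning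

  iterate-preserves : (Inv : (ℕ → Bool) → Set) → (∀ X → Inv X → Inv (step X)) →
                      ∀ f X → Inv X → Inv (iterate f X)
  iterate-preserves Inv pres zero    X inv = inv
  iterate-preserves Inv pres (suc f) X inv with grows? X
  ... | inj₁ _ = iterate-preserves Inv pres f (step X) (pres X inv)
  ... | inj₂ _ = inv

  closure : (ℕ → Bool) → ℕ → Bool
  closure = iterate (suc n)

  closure-closed : ∀ X → Closed (closure X)
  closure-closed X = iterate-closed (suc n) X (≤-trans (n<1+n n) (m≤m+n (suc n) (count X n)))

  closure-preserves : (Inv : (ℕ → Bool) → Set) → (∀ X → Inv X → Inv (step X)) → ∀ X → Inv X → Inv (closure X)
  closure-preserves Inv pres = iterate-preserves Inv pres (suc n)

module _ {k : ℕ} {S : List (ℕ × ℕ)} {u : List (Fin (suc k))} (gen : PalGen S u) where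

  PalGen-InS : All (InS (length u)) S
  PalGen-InS = proj₁ (proj₂ gen)

  PalGen-PalOn : PalOn S u
  PalGen-PalOn = proj₁ (proj₂ (proj₂ gen))

  PalGen-coding : (B : Set) → B → (v : List B) → length v ≡ length u → PalOn S v →
                  Σ (Fin (suc k) → B) (λ c → map c u ≡ v)
  PalGen-coding = proj₂ (proj₂ (proj₂ gen))

reflectStep : List (ℕ × ℕ) → (ℕ → Bool) → ℕ → Bool
reflectStep S X t = X t ∨ any (λ I → ((proj₁ I ≤ᵇ t) ∧ (t ≤ᵇ proj₂ I)) ∧ X (reflect I t)) S

reflectStep-inflationary : ∀ S X t → T (X t) → T (reflectStep S X t)
reflectStep-inflationary S X t x = Equivalence.from T-∨ (inj₁ x)

reflectStep-reflected : ∀ S X {I} → I ∈ S → ∀ t → t ∈ᴵ I → T (X (reflect I t)) → T (reflectStep S X t)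
reflectStep-reflected S X {i , j} I∈S t (i≤t , t≤j) x = Equivalence.from T-∨ (inj₂ (any⁺ _ (lose I∈S
  (Equivalence.from T-∧ (Equivalence.from T-∧ (≤⇒≤ᵇ i≤t , ≤⇒≤ᵇ t≤j) , x)))))

reflectStep-cases : ∀ S X t → T (reflectStep S X t) →
                    T (X t) ⊎ ∃ λ I → I ∈ S × t ∈ᴵ I × T (X (reflect I t))
reflectStep-cases S X t st with Equivalence.to T-∨ st
... | inj₁ x = inj₁ x
... | inj₂ r with find (any⁻ _ S r)
...   | (i , j) , I∈S , p with Equivalence.to T-∧ p
...     | bounds , x with Equivalence.to T-∧ bounds
...       | i≤t , t≤j = inj₂ ((i , j) , I∈S , (≤ᵇ⇒≤ i t i≤t , ≤ᵇ⇒≤ t j t≤j) , x)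

ReflectionClosed : List (ℕ × ℕ) → (ℕ → Set) → Set
ReflectionClosed S P = ∀ {I} → I ∈ S → ∀ t → t ∈ᴵ I → P t → P (reflect I t)

module _ {k : ℕ} {u : List (Fin (suc k))} {S : List (ℕ × ℕ)} (gen : PalGen S u) where

  private
    n : ℕ
    n = length u
    open Closure n (reflectStep S) (reflectStep-inflationary S)

    inRange : ∀ {I} → I ∈ S → InS n I
    inRange = All.lookup (PalGen-InS gen)

    ∈ᴵ-word : ∀ {I} → I ∈ S → ∀ {t} → t ∈ᴵ I → t ∈ᴵ (1 , n)
    ∈ᴵ-word I∈S (i≤t , t≤j) with inRange I∈S
    ... | 1≤i , _ , j≤n = ≤-trans 1≤i i≤t , ≤-trans t≤j j≤n

    reflect-∈ᴵ-word : ∀ {I} → I ∈ S → ∀ t → t ∈ᴵ I → reflect I t ∈ᴵ (1 , n)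
    reflect-∈ᴵ-word I∈S t t∈ = ∈ᴵ-word I∈S (reflect-∈ᴵ t t∈)

    closed-reflect : ∀ {X} → Closed X → ∀ {I} → I ∈ S → ∀ t → t ∈ᴵ I → T (X t) → T (X (reflect I t))
    closed-reflect {X} closed {I} I∈S t t∈ x = closed (reflect I t) (reflect-∈ᴵ-word I∈S t t∈)
      (reflectStep-reflected S X I∈S (reflect I t) (reflect-∈ᴵ t t∈)
        (subst (T ∘ X) (sym (reflect-involutive t t∈)) x))

    closed-symmetric : ∀ {X} → Closed X → ∀ {I} → I ∈ S → ∀ t → t ∈ᴵ I → X (reflect I t) ≡ X t
    closed-symmetric {X} closed {I} I∈S t t∈ = T-extensional
      (λ x → subst (T ∘ X) (reflect-involutive t t∈)
               (closed-reflect closed I∈S (reflect I t) (reflect-∈ᴵ t t∈) x))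
      (closed-reflect closed I∈S t t∈)

    word : (ℕ → Bool) → List Bool
    word X = applyUpTo (X ∘ suc) n

    length-word : ∀ X → length (word X) ≡ n
    length-word X = length-applyUpTo (X ∘ suc) n

    at-word : ∀ X t → t ∈ᴵ (1 , n) → at (word X) t ≡ just (X t)
    at-word X (suc m) (_ , m<n) = at-applyUpTo (X ∘ suc) n m m<n

    closed⇒PalOn : ∀ {X} → Closed X → PalOn S (word X)
    closed⇒PalOn {X} closed = All.tabulate λ {I} I∈S →
      trans (Mirrored⇒reverse-factor id (word X) (subst (λ l → InS l I) (sym (length-word X)) (inRange I∈S))
               (mirrored I∈S))
            (map-id _)
      where
      mirrored : ∀ {I} → I ∈ S → Mirrored id (word X) I
      mirrored {I} I∈S t t∈ = begin
        at (word X) (reflect I t)   ≡⟨ at-word X (reflect I t) (reflect-∈ᴵ-word I∈S t t∈) ⟩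
        just (X (reflect I t))      ≡⟨ cong just (closed-symmetric closed I∈S t t∈) ⟩
        just (X t)                  ≡⟨ cong (Maybe.map id) (at-word X t (∈ᴵ-word I∈S t∈)) ⟨
        Maybe.map id (at (word X) t) ∎
        where open ≡-Reasoning

    -- The characteristic word of a closed set is palindromic on S, hence a coding of u.
    closed⇒same-letter : ∀ {X} → Closed X → ∀ {t t′ x} → at u t ≡ just x → at u t′ ≡ just x → X t ≡ X t′
    closed⇒same-letter {X} closed {t} {t′} {x} ut ut′ = just-injective (begin
      just (X t)               ≡⟨ at-word X t (at-just⇒∈ᴵ u t ut) ⟨
      at (word X) t            ≡⟨ cong (λ w → at w t) (sym cu≡w) ⟩
      at (map c u) t           ≡⟨ at-map c u t ⟩
      Maybe.map c (at u t)     ≡⟨ cong (Maybe.map c) (trans ut (sym ut′)) ⟩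
      Maybe.map c (at u t′)    ≡⟨ at-map c u t′ ⟨
      at (map c u) t′          ≡⟨ cong (λ w → at w t′) cu≡w ⟩
      at (word X) t′           ≡⟨ at-word X t′ (at-just⇒∈ᴵ u t′ ut′) ⟩
      just (X t′)              ∎)
      where
      open ≡-Reasoning
      generated : Σ (Fin (suc k) → Bool) λ c → map c u ≡ word X
      generated = PalGen-coding gen Bool false (word X) (length-word X) (closed⇒PalOn closed)
      c : Fin (suc k) → Bool
      c = proj₁ generated
      cu≡w : map c u ≡ word X
      cu≡w = proj₂ generated

  reflection-closed⇒same-letter : (P : ℕ → Set) → ReflectionClosed S P →
    ∀ {t₀ t x} → at u t₀ ≡ just x → at u t ≡ just x → P t₀ → P t
  reflection-closed⇒same-letter P closedP {t₀} {t} ut₀ ut pt₀ =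
    orbit⊆P t (subst T (closed⇒same-letter (closure-closed (_≡ᵇ t₀)) ut₀ ut) t₀∈orbit)
    where
    orbit : ℕ → Bool
    orbit = closure (_≡ᵇ t₀)

    t₀∈orbit : T (orbit t₀)
    t₀∈orbit = closure-preserves (λ X → T (X t₀)) (λ X → reflectStep-inflationary S X t₀) (_≡ᵇ t₀)
                 (≡⇒≡ᵇ t₀ t₀ refl)

    ⊆P : (ℕ → Bool) → Set
    ⊆P X = ∀ t → T (X t) → P t

    ⊆P-step : ∀ X → ⊆P X → ⊆P (reflectStep S X)
    ⊆P-step X X⊆P t st with reflectStep-cases S X t st
    ... | inj₁ x = X⊆P t x
    ... | inj₂ (I , I∈S , t∈ , x) = subst P (reflect-involutive t t∈)
            (closedP I∈S (reflect I t) (reflect-∈ᴵ t t∈) (X⊆P (reflect I t) x))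

    orbit⊆P : ⊆P orbit
    orbit⊆P = closure-preserves ⊆P ⊆P-step (_≡ᵇ t₀) λ t eq → subst P (sym (≡ᵇ⇒≡ t t₀ eq)) pt₀

-- The doubling morphism

module _ {k : ℕ} (A : Subset (suc k)) where

  private
    F : Set
    F = Fin (suc k)

  block : F → List F
  block x with x ∈? A
  ... | yes _ = x ∷ x ∷ []
  ... | no  _ = x ∷ []

  width : F → ℕ
  width = length ∘ block

  d≡concat-map-block : ∀ u → d A u ≡ concat (map block u)
  d≡concat-map-block []      = refl
  d≡concat-map-block (x ∷ u) with x ∈? A
  ... | yes _ = cong (λ w → x ∷ x ∷ w) (d≡concat-map-block u)
  ... | no  _ = cong (x ∷_) (d≡concat-map-block u)

  block-palindrome : ∀ x → IsPalindrome (block x)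
  block-palindrome x with x ∈? A
  ... | yes _ = refl
  ... | no  _ = refl

  width-positive : ∀ x → 1 ≤ width x
  width-positive x with x ∈? A
  ... | yes _ = s≤s z≤n
  ... | no  _ = s≤s z≤n

  width-∉ : ∀ {x} → ¬ x Subset.∈ A → width x ≡ 1
  width-∉ {x} x∉A with x ∈? A
  ... | yes x∈A = contradiction x∈A x∉A
  ... | no  _   = refl

  map-block : (f : F → X) → ∀ x → map f (block x) ≡ map (λ _ → f x) (block x)
  map-block f x with x ∈? A
  ... | yes _ = refl
  ... | no  _ = refl

  -- A palindrome of the length of a block (one or two letters) is a constant word.
  palindrome-fits-block : ∀ x (b : X) (Bk : List X) → length Bk ≡ width x → IsPalindrome Bk →
                          map (λ _ → fromMaybe b (head Bk)) (block x) ≡ Bk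
  palindrome-fits-block x b Bk len pal with x ∈? A
  palindrome-fits-block x b (y ∷ .y ∷ []) _ refl | yes _ = refl
  palindrome-fits-block x b (y ∷ [])      _ _    | no  _ = refl

  block-determined : (c : F → List X) (b : X) → ∀ x → length (c x) ≡ width x → IsPalindrome (c x) →
                     map (fromMaybe b ∘ head ∘ c) (block x) ≡ c x
  block-determined c b x len pal =
    trans (map-block (fromMaybe b ∘ head ∘ c) x) (palindrome-fits-block x b (c x) len pal)

module Doubling {k : ℕ} (A : Subset (suc k)) (u : List (Fin (suc k))) where

  n : ℕ
  n = length u

  widths : List ℕ
  widths = map (width A) u

  -- The block of position i of u occupies positions offset (i - 1) + 1 .. offset i of d_A(u).
  φ : ℕ × ℕ → ℕ × ℕ
  φ (i , j) = suc (offset widths (i ∸ 1)) , offset widths j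

  widths-positive : All (1 ≤_) widths
  widths-positive = All.map⁺ (All.tabulate λ {x} _ → width-positive A x)

  length-widths : length widths ≡ n
  length-widths = length-map (width A) u

  map-length-blocks : map length (map (block A) u) ≡ widths
  map-length-blocks = sym (map-∘ u)

  length-d : length (d A u) ≡ sum widths
  length-d = trans (cong length (d≡concat-map-block A u))
                   (trans (length-concat (map (block A) u)) (cong sum map-length-blocks))

  φ-InS : ∀ {I} → InS n I → InS (length (d A u)) (φ I)
  φ-InS {suc a , j} (_ , a<j , j≤n) =
    s≤s z≤n ,
    offset-< widths widths-positive a<j (subst (j ≤_) (sym length-widths) j≤n) ,
    subst (offset widths j ≤_) (sym length-d) (offset-≤-sum widths j)

  φ-injective : ∀ {I J} → InS n I → InS n J → φ I ≡ φ J → I ≡ J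
  φ-injective {suc a , j} {suc a′ , j′} (_ , a<j , j≤n) (_ , a′<j′ , j′≤n) eq =
    cong₂ _,_ (cong suc (offset-injective widths widths-positive (bound (<⇒≤ (≤-trans a<j j≤n)))
                           (bound (<⇒≤ (≤-trans a′<j′ j′≤n))) (suc-injective (cong proj₁ eq))))
              (offset-injective widths widths-positive (bound j≤n) (bound j′≤n) (cong proj₂ eq))
    where
    bound : ∀ {m} → m ≤ n → m ≤ length widths
    bound = subst (_ ≤_) (sym length-widths)

  factor-φ : (Bs : List (List X)) → map length Bs ≡ widths → ∀ {I} → 1 ≤ proj₁ I →
             factor (concat Bs) (φ I) ≡ concat (factor Bs I)
  factor-φ Bs lengths {suc a , j} _ =
    subst (λ ls → factor (concat Bs) (suc (offset ls a) , offset ls j) ≡ concat (factor Bs (suc a , j)))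
          lengths (factor-concat Bs a j)

  factor-d-φ : ∀ {I} → 1 ≤ proj₁ I → factor (d A u) (φ I) ≡ concat (map (block A) (factor u I))
  factor-d-φ {I} 1≤i = begin
    factor (d A u) (φ I)                      ≡⟨ cong (λ w → factor w (φ I)) (d≡concat-map-block A u) ⟩
    factor (concat (map (block A) u)) (φ I)   ≡⟨ factor-φ (map (block A) u) map-length-blocks 1≤i ⟩
    concat (factor (map (block A) u) I)       ≡⟨ cong concat (factor-map (block A) u I) ⟩
    concat (map (block A) (factor u I))       ∎
    where open ≡-Reasoning

  IsPalindrome-d-φ : ∀ {I} → 1 ≤ proj₁ I → IsPalindrome (factor u I) → IsPalindrome (factor (d A u) (φ I))
  IsPalindrome-d-φ {I} 1≤i pal =
    subst IsPalindrome (sym (factor-d-φ 1≤i)) (IsPalindrome-concat⁺ (map (block A) s) (begin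
      reverse (map (block A) s)             ≡⟨ reverse-map (block A) s ⟨
      map (block A) (reverse s)             ≡⟨ cong (map (block A)) pal ⟩
      map (block A) s                       ≡⟨ map-cong-local (All.tabulate λ {x} _ → sym (block-palindrome A x)) ⟩
      map (reverse ∘ block A) s             ≡⟨ map-∘ s ⟩
      map reverse (map (block A) s)         ∎))
    where
    open ≡-Reasoning
    s : List (Fin (suc k))
    s = factor u I

  Unique-φ : ∀ {S} → All (InS n) S → Unique S → Unique (map φ S)
  Unique-φ = Unique-map⁺-on (InS n) φ φ-injective

  All-InS-φ : ∀ {S} → All (InS n) S → All (InS (length (d A u))) (map φ S)
  All-InS-φ inRange = All.map⁺ (All.map φ-InS inRange)

  PalOn-φ : ∀ {S} → All (InS n) S → PalOn S u → PalOn (map φ S) (d A u)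
  PalOn-φ inRange pal = All.map⁺ (All.zipWith (λ (I∈ , palI) → IsPalindrome-d-φ (proj₁ I∈) palI) (inRange , pal))

module Generation {k : ℕ} {u : List (Fin (suc k))} {S : List (ℕ × ℕ)} (gen : PalGen S u)
                  {p q : ℕ} (centre∈S : (p , p + 2 * q) ∈ S) {a : Fin (suc k)} (ua : at u (p + q) ≡ just a)
                  (B : Set) (b : B) (V : List B) (lengthV : length V ≡ length (d ⁅ a ⁆ u))
                  (palV : PalOn (map (Doubling.φ ⁅ a ⁆ u) S) V) where

  open Doubling ⁅ a ⁆ u

  private
    inRange : ∀ {I} → I ∈ S → InS n I
    inRange = All.lookup (PalGen-InS gen)

    length-V : length V ≡ sum widths
    length-V = trans lengthV length-d

  Bs : List (List B)
  Bs = chunk widths V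

  concat-Bs : concat Bs ≡ V
  concat-Bs = concat-chunk widths V length-V

  lengths-Bs : map length Bs ≡ widths
  lengths-Bs = map-length-chunk widths V length-V

  length-Bs : length Bs ≡ n
  length-Bs = trans (sym (length-map length Bs)) (trans (cong length lengths-Bs) length-widths)

  InS-Bs : ∀ {I} → I ∈ S → InS (length Bs) I
  InS-Bs {I} I∈S = subst (λ l → InS l I) (sym length-Bs) (inRange I∈S)

  reverse-factor-Bs : ∀ {I} → I ∈ S → reverse (factor Bs I) ≡ map reverse (factor Bs I)
  reverse-factor-Bs {I} I∈S = IsPalindrome-concat⁻ (factor Bs I) lengths-palindrome concat-palindrome
    where
    lengths≡ : map length (factor Bs I) ≡ map (width ⁅ a ⁆) (factor u I)
    lengths≡ = trans (sym (factor-map length Bs I))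
                     (trans (cong (λ ls → factor ls I) lengths-Bs) (factor-map (width ⁅ a ⁆) u I))
    lengths-palindrome : IsPalindrome (map length (factor Bs I))
    lengths-palindrome = subst IsPalindrome (sym lengths≡)
                           (IsPalindrome-map (width ⁅ a ⁆) (All.lookup (PalGen-PalOn gen) I∈S))
    concat-palindrome : IsPalindrome (concat (factor Bs I))
    concat-palindrome = subst IsPalindrome
      (trans (cong (λ w → factor w (φ I)) (sym concat-Bs)) (factor-φ Bs lengths-Bs (proj₁ (inRange I∈S))))
      (All.lookup palV (∈-map⁺ φ I∈S))

  blocks-mirrored : ∀ {I} → I ∈ S → Mirrored reverse Bs I
  blocks-mirrored I∈S = reverse-factor⇒Mirrored reverse Bs (InS-Bs I∈S) (reverse-factor-Bs I∈S)

  PalindromicBlockAt : ℕ → Set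
  PalindromicBlockAt t = Maybe.map reverse (at Bs t) ≡ at Bs t

  PalindromicBlockAt-reflection-closed : ReflectionClosed S PalindromicBlockAt
  PalindromicBlockAt-reflection-closed {I} I∈S t t∈ pal = begin
    Maybe.map reverse (at Bs (reflect I t))                ≡⟨ cong (Maybe.map reverse) (blocks-mirrored I∈S t t∈) ⟩
    Maybe.map reverse (Maybe.map reverse (at Bs t))        ≡⟨ Maybe-map-reverse-involutive (at Bs t) ⟩
    at Bs t                                                ≡⟨ pal ⟨
    Maybe.map reverse (at Bs t)                            ≡⟨ blocks-mirrored I∈S t t∈ ⟨
    at Bs (reflect I t)                                    ∎
    where open ≡-Reasoning

  -- The block in the middle of the palindrome (p , p + 2q) is its own mirror image.
  PalindromicBlockAt-centre : PalindromicBlockAt (p + q)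
  PalindromicBlockAt-centre = sym (begin
    at Bs (p + q)                                ≡⟨ cong (at Bs) (reflect-centre p q) ⟨
    at Bs (reflect (p , p + 2 * q) (p + q))      ≡⟨ blocks-mirrored centre∈S (p + q) centre∈ ⟩
    Maybe.map reverse (at Bs (p + q))            ∎)
    where
    open ≡-Reasoning
    centre∈ : p + q ∈ᴵ (p , p + 2 * q)
    centre∈ = m≤m+n p q , +-monoʳ-≤ p (m≤m+n q (q + 0))

  length-block-at : ∀ t {Bk x} → at Bs t ≡ just Bk → at u t ≡ just x → length Bk ≡ width ⁅ a ⁆ x
  length-block-at t {Bk} {x} Bs-t u-t = just-injective (begin
    just (length Bk)                      ≡⟨ cong (Maybe.map length) Bs-t ⟨
    Maybe.map length (at Bs t)            ≡⟨ at-map length Bs t ⟨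
    at (map length Bs) t                  ≡⟨ cong (λ ls → at ls t) lengths-Bs ⟩
    at widths t                           ≡⟨ at-map (width ⁅ a ⁆) u t ⟩
    Maybe.map (width ⁅ a ⁆) (at u t)      ≡⟨ cong (Maybe.map (width ⁅ a ⁆)) u-t ⟩
    just (width ⁅ a ⁆ x)                  ∎)
    where open ≡-Reasoning

  block-palindromic : ∀ t {Bk} → at Bs t ≡ just Bk → IsPalindrome Bk
  block-palindromic t {Bk} Bs-t with at-∈ᴵ⇒just u t (subst (λ l → t ∈ᴵ (1 , l)) length-Bs (at-just⇒∈ᴵ Bs t Bs-t))
  ... | x , u-t with x ∈? ⁅ a ⁆
  ...   | no x∉ = length-1-palindrome Bk (trans (length-block-at t Bs-t u-t) (width-∉ ⁅ a ⁆ x∉))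
  ...   | yes x∈ = just-injective (begin
          just (reverse Bk)                ≡⟨ cong (Maybe.map reverse) Bs-t ⟨
          Maybe.map reverse (at Bs t)      ≡⟨ reflection-closed⇒same-letter gen PalindromicBlockAt
                                                PalindromicBlockAt-reflection-closed ua
                                                (trans u-t (cong just (x∈⁅y⁆⇒x≡y a x∈)))
                                                PalindromicBlockAt-centre ⟩
          at Bs t                          ≡⟨ Bs-t ⟩
          just Bk                          ∎)
    where open ≡-Reasoning

  blocks-palindromic : All IsPalindrome Bs
  blocks-palindromic = All-from-at IsPalindrome Bs (block-palindromic ∘ suc)

  PalOn-Bs : PalOn S Bs
  PalOn-Bs = All.tabulate λ {I} I∈S → begin
    reverse (factor Bs I)               ≡⟨ reverse-factor-Bs I∈S ⟩
    map reverse (factor Bs I)           ≡⟨ factor-map reverse Bs I ⟨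
    factor (map reverse Bs) I           ≡⟨ cong (λ Cs → factor Cs I) (map-id-local blocks-palindromic) ⟩
    factor Bs I                         ∎
    where open ≡-Reasoning

  private
    generated : Σ (Fin (suc k) → List B) λ c → map c u ≡ Bs
    generated = PalGen-coding gen (List B) [] Bs length-Bs PalOn-Bs

    c : Fin (suc k) → List B
    c = proj₁ generated

    c-u : map c u ≡ Bs
    c-u = proj₂ generated

  letter-image : Fin (suc k) → B
  letter-image = fromMaybe b ∘ head ∘ c

  letter-image-d : map letter-image (d ⁅ a ⁆ u) ≡ V
  letter-image-d = begin
    map letter-image (d ⁅ a ⁆ u)                          ≡⟨ cong (map letter-image) (d≡concat-map-block ⁅ a ⁆ u) ⟩
    map letter-image (concat (map (block ⁅ a ⁆) u))       ≡⟨ concat-map (map (block ⁅ a ⁆) u) ⟨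
    concat (map (map letter-image) (map (block ⁅ a ⁆) u)) ≡⟨ cong concat (map-∘ u) ⟨
    concat (map (map letter-image ∘ block ⁅ a ⁆) u)       ≡⟨ cong concat (map-cong-local blocks-determined) ⟩
    concat (map c u)                                      ≡⟨ cong concat c-u ⟩
    concat Bs                                             ≡⟨ concat-Bs ⟩
    V                                                     ∎
    where
    open ≡-Reasoning
    c-widths : All (λ x → length (c x) ≡ width ⁅ a ⁆ x) u
    c-widths = map-≡⇒All (length ∘ c) (width ⁅ a ⁆) u
                 (trans (map-∘ u) (trans (cong (map length) c-u) lengths-Bs))
    c-palindromes : All (IsPalindrome ∘ c) u
    c-palindromes = All.map⁻ (subst (All IsPalindrome) (sym c-u) blocks-palindromic)
    blocks-determined : All (λ x → map letter-image (block ⁅ a ⁆ x) ≡ c x) u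
    blocks-determined =
      All.zipWith (λ {x} (len , pal) → block-determined ⁅ a ⁆ c b x len pal) (c-widths , c-palindromes)

lemma5 : {k : ℕ} (u : List (Fin (suc k))) (S : List (ℕ × ℕ)) → PalGen S u →
         (p q : ℕ) → 1 ≤ p → (p , p + 2 * q) ∈ S →
         (a : Fin (suc k)) → at u (p + q) ≡ just a →
         μ≤ (d ⁅ a ⁆ u) (length S)
lemma5 u S gen@(unique , inRange , palindromic , _) p q _ centre∈S a ua =
  map φ S ,
  (Unique-φ inRange unique , All-InS-φ inRange , PalOn-φ inRange palindromic ,
   λ B b V lengthV palV →
     let open Generation gen centre∈S ua B b V lengthV palV in letter-image , letter-image-d) ,
  ≤-reflexive (length-map φ S)
  where open Doubling ⁅ a ⁆ u
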